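{- Let $\alpha=(a_p)_p\in\mathcal{A}$ and suppose there exists a strictly increasing sequence of positive integers $(a'_n)_n$ such that for every $n$ there are infinitely many primes $p$ with $a_p=a'_n\bmod p$. Let $\beta=(b_p)_p\in\mathcal{A}$ and suppose there exists a sequence of integers $(b'_p)_p$ with $b'_p\to\infty$ and $(b'_p)^d=o(p)$ as $p\to\infty$ for every positive integer $d$, such that $b_p=b'_p\bmod p$. Then $\alpha$ and $\beta$ are algebraically independent over $\mathbb{Q}$.
   Context: $\mathcal{A}\coloneqq\bigl(\prod_{p}\mathbb{Z}/p\mathbb{Z}\bigr)/\bigl(\bigoplus_{p}\mathbb{Z}/p\mathbb{Z}\bigr)$ over all primes $p$; elements are written $(a_p)_p$ with $a_p\in\mathbb{Z}/p\mathbb{Z}$, equal iff components agree for all but finitely many primes. Elements $\alpha,\beta\in\mathcal{A}$ are algebraically independent over $\mathbb{Q}$ if $F(\alpha,\beta)\neq0$ in $\mathcal{A}$ for every nonzero $F(x,y)\in\mathbb{Z}[x,y]$. -}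

module Defs where

open import Data.Nat using (ℕ; zero; suc; _≤_; _<_; _*_; _^_)
open import Data.Nat.Primality using (Prime)
open import Data.Integer as ℤ using (ℤ; +_; ∣_∣)
open import Data.Integer.Divisibility using (_∣_)
open import Data.List using (List; []; _∷_)
open import Data.List.Relation.Unary.Any using (Any)
open import Data.Product using (Σ; _×_)
open import Relation.Binary.PropositionalEquality using (_≢_)
open import Relation.Nullary using (¬_)

-- An element of 𝒜 = (∏_p ℤ/pℤ)/(⊕_p ℤ/pℤ) is represented by a function
-- giving, for each prime p, an integer representative of a_p ∈ ℤ/pℤ
-- (values at non-primes are irrelevant).
Seq𝒜 : Set
Seq𝒜 = ℕ → ℤ

IsZero𝒜 : Seq𝒜 → Set
IsZero𝒜 x = Σ ℕ λ N → (p : ℕ) → Prime p → N ≤ p → (+ p) ∣ x p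

-- Polynomials in ℤ[x,y]: F = Σ_i Σ_j c_ij x^i y^j, stored as a list
-- (indexed by i) of lists (indexed by j) of coefficients c_ij.
Poly₂ : Set
Poly₂ = List (List ℤ)

NonZeroPoly : Poly₂ → Set
NonZeroPoly F = Any (Any (λ c → c ≢ + 0)) F

evalY : List ℤ → ℤ → ℤ
evalY []       y = + 0
evalY (c ∷ cs) y = c ℤ.+ y ℤ.* evalY cs y

eval₂ : Poly₂ → ℤ → ℤ → ℤ
eval₂ []       x y = + 0
eval₂ (r ∷ rs) x y = evalY r y ℤ.+ x ℤ.* eval₂ rs x y

apply₂ : Poly₂ → Seq𝒜 → Seq𝒜 → Seq𝒜
apply₂ F α β p = eval₂ F (α p) (β p)

AlgIndep : Seq𝒜 → Seq𝒜 → Set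
AlgIndep α β = (F : Poly₂) → NonZeroPoly F → ¬ IsZero𝒜 (apply₂ F α β)

-- If F ≠ 0, there is X such that for every integer x with |x| > X the
-- polynomial F(x, y) ∈ ℤ[y] is nonzero, hence has no root y with |y| beyond
-- some Y.  Take x = a′ₙ with n > X and a prime p, as large as needed, with
-- a_p ≡ x.  Then G = F(x, b′_p) is a nonzero integer with
-- G ≡ F(a_p, b_p) ≡ 0 mod p, and yet |G| ≤ C·|b′_p|^D < p because b′_p grows
-- more slowly than every root of p.
module Submission where

open import Defs
open import Data.Nat using (ℕ; suc; _≤_; _<_; _*_; _^_)
open import Data.Nat.Primality using (Prime)
open import Data.Integer as ℤ using (ℤ; +_; ∣_∣; _-_)
open import Data.Integer.Divisibility using (_∣_)
open import Data.Product using (Σ; _×_)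

open import Data.Nat as ℕ using (zero; _⊔_; NonZero; ≢-nonZero; >-nonZero)
open import Data.Nat.Properties
  using (<⇒≱; n≮0; ≤-trans; ≤-<-trans; m≤m*n; m^n≢0; *-monoʳ-≤; *-monoˡ-<; +-mono-≤;
         n<1+n; n≤1+n; m⊔n≤o⇒m≤o; m⊔n≤o⇒n≤o; module ≤-Reasoning)
open import Data.Nat.Divisibility using (_∣0; ∣⇒≤)
open import Data.Nat.ListAction using (sum)
import Data.Nat.Tactic.RingSolver as ℕ-Solver
open import Data.Integer.Properties
  using (abs-*; ∣i+j∣≤∣i∣+∣j∣; ∣i∣≡0⇒i≡0; +-inverseʳ; +-identityˡ; *-zeroʳ; i*j≡0⇒i≡0∨j≡0)
import Data.Integer.Divisibility.Signed as Signed
open import Data.Integer.Tactic.RingSolver using (solve-∀)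
open import Data.List using (List; []; _∷_; map; length; drop)
open import Data.List.Relation.Unary.Any using (Any; here; there)
open import Data.List.Relation.Unary.Any.Properties using (map⁺)
open import Data.Product as Product using (_,_)
open import Data.Sum using (_⊎_; inj₁; inj₂; [_,_])
open import Data.Empty using (⊥-elim)
open import Function using (_∘_; _$_; id)
open import Relation.Binary.PropositionalEquality
  using (_≡_; _≢_; refl; sym; trans; subst; cong; cong₂; module ≡-Reasoning)
open import Relation.Nullary using (yes; no)

-- A record rather than a synonym for  k ∣ u - v,  so that u, v and k can be inferred.
infix 4 _≡_[mod_]
record _≡_[mod_] (u v k : ℤ) : Set where
  constructor mod
  field ∣-diff : k Signed.∣ u - v

module _ {k : ℤ} where

  mod-refl : ∀ u → u ≡ u [mod k ]
  mod-refl u = mod (subst (k Signed.∣_) (sym (+-inverseʳ u)) (Signed.∣ᵤ⇒∣ (∣ k ∣ ∣0)))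

  +-cong-mod : ∀ {u u′ v v′} → u ≡ u′ [mod k ] → v ≡ v′ [mod k ] → u ℤ.+ v ≡ u′ ℤ.+ v′ [mod k ]
  +-cong-mod {u} {u′} {v} {v′} (mod k∣u-u′) (mod k∣v-v′) = mod $
    subst (k Signed.∣_) (sym (regroup u u′ v v′)) (Signed.∣m∣n⇒∣m+n k∣u-u′ k∣v-v′)
    where
    regroup : ∀ u u′ v v′ → (u ℤ.+ v) - (u′ ℤ.+ v′) ≡ (u - u′) ℤ.+ (v - v′)
    regroup = solve-∀

  *-cong-mod : ∀ {u u′ v v′} → u ≡ u′ [mod k ] → v ≡ v′ [mod k ] → u ℤ.* v ≡ u′ ℤ.* v′ [mod k ]
  *-cong-mod {u} {u′} {v} {v′} (mod k∣u-u′) (mod k∣v-v′) = mod $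
    subst (k Signed.∣_) (sym (regroup u u′ v v′))
      (Signed.∣m∣n⇒∣m+n (Signed.∣n⇒∣m*n u k∣v-v′) (Signed.∣m⇒∣m*n v′ k∣u-u′))
    where
    regroup : ∀ u u′ v v′ → u ℤ.* v - u′ ℤ.* v′ ≡ u ℤ.* (v - v′) ℤ.+ (u - u′) ℤ.* v′
    regroup = solve-∀

  ∣-resp-mod : ∀ {u v} → k Signed.∣ u → u ≡ v [mod k ] → k Signed.∣ v
  ∣-resp-mod {u} {v} k∣u (mod k∣u-v) = subst (k Signed.∣_) (cancel u v) (Signed.∣m∣n⇒∣m-n k∣u k∣u-v)
    where
    cancel : ∀ u v → u - (u - v) ≡ v
    cancel = solve-∀

  evalY-cong-mod : ∀ cs {y y′} → y ≡ y′ [mod k ] → evalY cs y ≡ evalY cs y′ [mod k ]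
  evalY-cong-mod []       y≡y′ = mod-refl (+ 0)
  evalY-cong-mod (c ∷ cs) y≡y′ = +-cong-mod (mod-refl c) (*-cong-mod y≡y′ (evalY-cong-mod cs y≡y′))

  eval₂-cong-mod : ∀ F {x x′ y y′} → x ≡ x′ [mod k ] → y ≡ y′ [mod k ] →
                   eval₂ F x y ≡ eval₂ F x′ y′ [mod k ]
  eval₂-cong-mod []       x≡x′ y≡y′ = mod-refl (+ 0)
  eval₂-cong-mod (r ∷ rs) x≡x′ y≡y′ =
    +-cong-mod (evalY-cong-mod r y≡y′) (*-cong-mod x≡x′ (eval₂-cong-mod rs x≡x′ y≡y′))

∣⇒∣∣≤∣∣ : ∀ {k z} → k Signed.∣ z → z ≢ + 0 → ∣ k ∣ ≤ ∣ z ∣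
∣⇒∣∣≤∣∣ k∣z z≢0 = ∣⇒≤ {{≢-nonZero (z≢0 ∘ ∣i∣≡0⇒i≡0)}} (Signed.∣⇒∣ᵤ k∣z)

m<∣i∣⇒i≢0 : ∀ {m i} → m < ∣ i ∣ → i ≢ + 0
m<∣i∣⇒i≢0 m<0 refl = n≮0 m<0

root∣constant : ∀ {c} y e → c ℤ.+ y ℤ.* e ≡ + 0 → y Signed.∣ c
root∣constant y e c+ye≡0 =
  Signed.∣m+n∣n⇒∣m (subst (y Signed.∣_) (sym c+ye≡0) (Signed.∣ᵤ⇒∣ (∣ y ∣ ∣0)))
                   (Signed.∣m⇒∣m*n e Signed.∣-refl)

EventuallyNonZero : (ℤ → ℤ) → Set
EventuallyNonZero f = Σ ℕ λ B → ∀ y → B < ∣ y ∣ → f y ≢ + 0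

-- If c ≠ 0, a root y of c + y·g(y) divides c, so |y| ≤ |c|;
-- if c = 0, the roots are 0 and the roots of g.
horner-eventuallyNonZero : ∀ {f g : ℤ → ℤ} c → (∀ y → f y ≡ c ℤ.+ y ℤ.* g y) →
                           c ≢ + 0 ⊎ EventuallyNonZero g → EventuallyNonZero f
horner-eventuallyNonZero {g = g} c f≗ c≢0⊎g with c ℤ.≟ + 0 | c≢0⊎g
... | no c≢0   | _              = ∣ c ∣ , λ y ∣c∣<∣y∣ fy≡0 →
  <⇒≱ ∣c∣<∣y∣ (∣⇒∣∣≤∣∣ (root∣constant y (g y) (trans (sym (f≗ y)) fy≡0)) c≢0)
... | yes c≡0  | inj₁ c≢0       = ⊥-elim (c≢0 c≡0)
... | yes refl | inj₂ (B , g≢0) = B , λ y B<∣y∣ fy≡0 →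
  [ m<∣i∣⇒i≢0 B<∣y∣ , g≢0 y B<∣y∣ ]
    (i*j≡0⇒i≡0∨j≡0 y (trans (sym (+-identityˡ _)) (trans (sym (f≗ y)) fy≡0)))

evalY-eventuallyNonZero : ∀ {cs} → Any (_≢ + 0) cs → EventuallyNonZero (evalY cs)
evalY-eventuallyNonZero {c ∷ _} (here c≢0)   = horner-eventuallyNonZero c (λ _ → refl) (inj₁ c≢0)
evalY-eventuallyNonZero {c ∷ _} (there cs≢0) =
  horner-eventuallyNonZero c (λ _ → refl) (inj₂ (evalY-eventuallyNonZero cs≢0))

coeff : ℕ → List ℤ → ℤ
coeff zero    []      = + 0
coeff zero    (c ∷ _) = c
coeff (suc j) cs      = coeff j (drop 1 cs)

coeffY₀ : Poly₂ → List ℤ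
coeffY₀ = map (coeff 0)

dropY : Poly₂ → Poly₂
dropY = map (drop 1)

eval₂-splitY : ∀ F x y → eval₂ F x y ≡ evalY (coeffY₀ F) x ℤ.+ y ℤ.* eval₂ (dropY F) x y
eval₂-splitY []       x y = trans (sym (*-zeroʳ y)) (sym (+-identityˡ _))
eval₂-splitY (r ∷ rs) x y = begin
  evalY r y ℤ.+ x ℤ.* eval₂ rs x y
    ≡⟨ cong₂ (λ u v → u ℤ.+ x ℤ.* v) (evalY-splitY r) (eval₂-splitY rs x y) ⟩
  (c₀ ℤ.+ y ℤ.* R) ℤ.+ x ℤ.* (H ℤ.+ y ℤ.* T)
    ≡⟨ regroup x y c₀ R H T ⟩
  (c₀ ℤ.+ x ℤ.* H) ℤ.+ y ℤ.* (R ℤ.+ x ℤ.* T) ∎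
  where
  open ≡-Reasoning
  c₀ = coeff 0 r
  R  = evalY (drop 1 r) y
  H  = evalY (coeffY₀ rs) x
  T  = eval₂ (dropY rs) x y
  evalY-splitY : ∀ r → evalY r y ≡ coeff 0 r ℤ.+ y ℤ.* evalY (drop 1 r) y
  evalY-splitY []      = trans (sym (*-zeroʳ y)) (sym (+-identityˡ _))
  evalY-splitY (_ ∷ _) = refl
  regroup : ∀ x y c₀ R H T → (c₀ ℤ.+ y ℤ.* R) ℤ.+ x ℤ.* (H ℤ.+ y ℤ.* T) ≡
                             (c₀ ℤ.+ x ℤ.* H) ℤ.+ y ℤ.* (R ℤ.+ x ℤ.* T)
  regroup = solve-∀

EventuallyNonZero₂ : (ℤ → ℤ → ℤ) → Set
EventuallyNonZero₂ f = Σ ℕ λ X → ∀ x → X < ∣ x ∣ → EventuallyNonZero (f x)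

column-eventuallyNonZero : ∀ j F → Any (λ r → coeff j r ≢ + 0) F → EventuallyNonZero₂ (eval₂ F)
column-eventuallyNonZero zero    F F₀≢0 =
  let X , F₀[x]≢0 = evalY-eventuallyNonZero (map⁺ F₀≢0)
  in  X , λ x X<∣x∣ →
        horner-eventuallyNonZero (evalY (coeffY₀ F) x) (eval₂-splitY F x) (inj₁ (F₀[x]≢0 x X<∣x∣))
column-eventuallyNonZero (suc j) F Fⱼ₊₁≢0 =
  let X , F₁[x,-]≢0 = column-eventuallyNonZero j (dropY F) (map⁺ Fⱼ₊₁≢0)
  in  X , λ x X<∣x∣ →
        horner-eventuallyNonZero (evalY (coeffY₀ F) x) (eval₂-splitY F x) (inj₂ (F₁[x,-]≢0 x X<∣x∣))

nonZeroColumn : ∀ {F} → NonZeroPoly F → Σ ℕ λ j → Any (λ r → coeff j r ≢ + 0) F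
nonZeroColumn (here r≢0)  = Product.map id here (nonZeroCoeff r≢0)
  where
  nonZeroCoeff : ∀ {cs} → Any (_≢ + 0) cs → Σ ℕ λ j → coeff j cs ≢ + 0
  nonZeroCoeff (here c≢0)   = 0 , c≢0
  nonZeroCoeff (there cs≢0) = Product.map suc id (nonZeroCoeff cs≢0)
nonZeroColumn (there F≢0) = Product.map id there (nonZeroColumn F≢0)

eval₂-eventuallyNonZero : ∀ F → NonZeroPoly F → EventuallyNonZero₂ (eval₂ F)
eval₂-eventuallyNonZero F F≢0 =
  let j , Fⱼ≢0 = nonZeroColumn F≢0 in column-eventuallyNonZero j F Fⱼ≢0

absSum : List ℤ → ℕ
absSum cs = sum (map ∣_∣ cs)

absSum₂ : Poly₂ → ℕ → ℕ
absSum₂ []       s = 0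
absSum₂ (r ∷ rs) s = absSum r ℕ.+ s * absSum₂ rs s

maxRowLength : Poly₂ → ℕ
maxRowLength []       = 0
maxRowLength (r ∷ rs) = length r ⊔ maxRowLength rs

module _ (y : ℤ) .{{_ : NonZero ∣ y ∣}} where
  open ≤-Reasoning
  private t = ∣ y ∣

  ∣evalY∣≤ : ∀ cs D → length cs ≤ D → ∣ evalY cs y ∣ ≤ absSum cs * t ^ D
  ∣evalY∣≤ []       D       _             = ℕ.z≤n
  ∣evalY∣≤ (c ∷ cs) (suc D) (ℕ.s≤s len≤D) = begin
    ∣ c ℤ.+ y ℤ.* evalY cs y ∣                    ≤⟨ ∣i+j∣≤∣i∣+∣j∣ c _ ⟩
    ∣ c ∣ ℕ.+ ∣ y ℤ.* evalY cs y ∣                ≡⟨ cong (∣ c ∣ ℕ.+_) (abs-* y _) ⟩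
    ∣ c ∣ ℕ.+ t * ∣ evalY cs y ∣
      ≤⟨ +-mono-≤ (m≤m*n ∣ c ∣ (t ^ suc D) {{m^n≢0 t (suc D)}})
                  (*-monoʳ-≤ t (∣evalY∣≤ cs D len≤D)) ⟩
    ∣ c ∣ * t ^ suc D ℕ.+ t * (absSum cs * t ^ D) ≡⟨ regroup ∣ c ∣ (absSum cs) t (t ^ D) ⟩
    (∣ c ∣ ℕ.+ absSum cs) * t ^ suc D             ∎
    where
    regroup : ∀ c s t u → c * (t * u) ℕ.+ t * (s * u) ≡ (c ℕ.+ s) * (t * u)
    regroup = ℕ-Solver.solve-∀

  ∣eval₂∣≤ : ∀ F x D → maxRowLength F ≤ D → ∣ eval₂ F x y ∣ ≤ absSum₂ F ∣ x ∣ * t ^ D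
  ∣eval₂∣≤ []       x D _     = ℕ.z≤n
  ∣eval₂∣≤ (r ∷ rs) x D len≤D = begin
    ∣ evalY r y ℤ.+ x ℤ.* eval₂ rs x y ∣       ≤⟨ ∣i+j∣≤∣i∣+∣j∣ (evalY r y) _ ⟩
    ∣ evalY r y ∣ ℕ.+ ∣ x ℤ.* eval₂ rs x y ∣   ≡⟨ cong (∣ evalY r y ∣ ℕ.+_) (abs-* x _) ⟩
    ∣ evalY r y ∣ ℕ.+ ∣ x ∣ * ∣ eval₂ rs x y ∣
      ≤⟨ +-mono-≤ (∣evalY∣≤ r D (m⊔n≤o⇒m≤o _ _ len≤D))
                  (*-monoʳ-≤ ∣ x ∣ (∣eval₂∣≤ rs x D (m⊔n≤o⇒n≤o _ _ len≤D))) ⟩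
    absSum r * t ^ D ℕ.+ ∣ x ∣ * (absSum₂ rs ∣ x ∣ * t ^ D)
      ≡⟨ regroup (absSum r) ∣ x ∣ (absSum₂ rs ∣ x ∣) (t ^ D) ⟩
    (absSum r ℕ.+ ∣ x ∣ * absSum₂ rs ∣ x ∣) * t ^ D ∎
    where
    regroup : ∀ s x c u → s * u ℕ.+ x * (c * u) ≡ (s ℕ.+ x * c) * u
    regroup = ℕ-Solver.solve-∀

  ∣eval₂∣< : ∀ F x {p} → suc (absSum₂ F ∣ x ∣) * t ^ suc (maxRowLength F) ≤ p →
             ∣ eval₂ F x y ∣ < p
  ∣eval₂∣< F x {p} bound = begin-strict
    ∣ eval₂ F x y ∣                   ≤⟨ ∣eval₂∣≤ F x (suc D) (n≤1+n D) ⟩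
    absSum₂ F ∣ x ∣ * t ^ suc D       <⟨ *-monoˡ-< (t ^ suc D) {{m^n≢0 t (suc D)}} (n<1+n (absSum₂ F ∣ x ∣)) ⟩
    suc (absSum₂ F ∣ x ∣) * t ^ suc D ≤⟨ bound ⟩
    p                                 ∎
    where D = maxRowLength F

increasing⇒n≤f[n] : ∀ {f : ℕ → ℕ} → (∀ n → f n < f (suc n)) → ∀ n → n ≤ f n
increasing⇒n≤f[n] f-increasing zero    = ℕ.z≤n
increasing⇒n≤f[n] f-increasing (suc n) =
  ≤-trans (ℕ.s≤s (increasing⇒n≤f[n] f-increasing n)) (f-increasing n)

+[1+m]≤i⇒m<∣i∣ : ∀ {m i} → + suc m ℤ.≤ i → m < ∣ i ∣
+[1+m]≤i⇒m<∣i∣ (ℤ.+≤+ m<n) = m<n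

lemma7p3 : (a : Seq𝒜) (a′ : ℕ → ℕ)
    → ((n : ℕ) → 0 < a′ n)
    → ((n : ℕ) → a′ n < a′ (suc n))
    → ((n M : ℕ) → Σ ℕ λ p → M ≤ p × Prime p × (+ p) ∣ (a p - + a′ n))
    → (b : Seq𝒜) (b′ : ℕ → ℤ)
    → ((K : ℤ) → Σ ℕ λ N → (p : ℕ) → Prime p → N ≤ p → K ℤ.≤ b′ p)
    → ((d m : ℕ) → Σ ℕ λ N → (p : ℕ) → Prime p → N ≤ p → suc m * ∣ b′ p ∣ ^ suc d ≤ p)
    → ((p : ℕ) → Prime p → (+ p) ∣ (b p - b′ p))
    → AlgIndep a b
lemma7p3 a a′ _ a′-increasing a≡a′ b b′ b′→∞ b′-small b≡b′ F F≢0 (N₀ , p∣F[a,b]) =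
  let X , F[x,-]≢0            = eval₂-eventuallyNonZero F F≢0
      x                       = + a′ (suc X)
      Y , F[x,y]≢0            = F[x,-]≢0 x (increasing⇒n≤f[n] a′-increasing (suc X))
      N₁ , b′>Y               = b′→∞ (+ suc Y)
      N₂ , b′≪p               = b′-small (maxRowLength F) (absSum₂ F ∣ x ∣)
      p , N≤p , p-prime , a≡x = a≡a′ (suc X) (N₀ ⊔ N₁ ⊔ N₂)
      N₀⊔N₁≤p                 = m⊔n≤o⇒m≤o (N₀ ⊔ N₁) N₂ N≤p
      y                       = b′ p
      Y<∣y∣                   = +[1+m]≤i⇒m<∣i∣ (b′>Y p p-prime (m⊔n≤o⇒n≤o N₀ N₁ N₀⊔N₁≤p))
      p∣G = ∣-resp-mod (Signed.∣ᵤ⇒∣ {+ p} (p∣F[a,b] p p-prime (m⊔n≤o⇒m≤o N₀ N₁ N₀⊔N₁≤p)))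
                       (eval₂-cong-mod F (mod (Signed.∣ᵤ⇒∣ {+ p} a≡x))
                                         (mod (Signed.∣ᵤ⇒∣ {+ p} (b≡b′ p p-prime))))
      ∣G∣<p = ∣eval₂∣< y {{>-nonZero (≤-<-trans ℕ.z≤n Y<∣y∣)}} F x
                       (b′≪p p p-prime (m⊔n≤o⇒n≤o (N₀ ⊔ N₁) N₂ N≤p))
  in  <⇒≱ ∣G∣<p (∣⇒∣∣≤∣∣ p∣G (F[x,y]≢0 y Y<∣y∣))
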